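{- There exists a regular-oriented word equation together with a set of regular constraints whose length abstraction is not Presburger-definable.
   Context: Fix a finite alphabet $A$ of constants and variables $V$, disjoint. A word equation is $L=R$ with $L,R\in(A\cup V)^*$; it is regular if each variable occurs at most once in $L$ and at most once in $R$; oriented if there is a total order $<$ on $V$ such that for $w\in\{L,R\}$, whenever $w=w_1\alpha w_2\beta w_3$ with $\alpha,\beta\in V$, then $\alpha<\beta$; regular-oriented if both. A solution is a homomorphism $\sigma:(A\cup V)^*\to A^*$ fixing constants with $\sigma(L)=\sigma(R)$; a regular constraint $x\in\mathcal{L}$ ($\mathcal{L}$ a regular language) requires $\sigma(x)\in\mathcal{L}$. The length abstraction of an equation with variables $x_1,\dots,x_k$ and regular constraints $S$ is $\{(|\sigma(x_1)|,\dots,|\sigma(x_k)|):\sigma$ a solution satisfying all constraints in $S\}\subseteq\mathbb{N}^k$. Presburger-definable means definable by a first-order formula over the natural numbers with addition and order. -}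

module Defs where

open import Data.Nat using (ℕ; zero; suc; _+_; _≤_)
open import Data.Fin using (Fin; zero; suc)
import Data.Fin as Fin
open import Data.Bool using (Bool; true)
open import Data.List using (List; []; _∷_; _++_; length)
open import Data.Sum using (_⊎_; inj₁; inj₂)
open import Data.Product using (Σ; ∃; _×_; _,_)
open import Data.List.Relation.Unary.All using (All)
open import Relation.Nullary using (¬_; yes; no)
open import Relation.Binary.PropositionalEquality using (_≡_)
open import Relation.Binary.Structures using (IsStrictTotalOrder)
open import Function.Bundles using (_⇔_)

Symbol : ℕ → ℕ → Set
Symbol a k = Fin a ⊎ Fin k

Word : ℕ → ℕ → Set
Word a k = List (Symbol a k)

record WordEquation (a k : ℕ) : Set where
  constructor _≐_
  field
    lhs : Word a k
    rhs : Word a k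
open WordEquation public

occ : ∀ {a k} → Fin k → Word a k → ℕ
occ x [] = 0
occ x (inj₁ c ∷ w) = occ x w
occ x (inj₂ y ∷ w) with x Fin.≟ y
... | yes _ = suc (occ x w)
... | no _  = occ x w

Regular : ∀ {a k} → WordEquation a k → Set
Regular {k = k} (L ≐ R) = (x : Fin k) → occ x L ≤ 1 × occ x R ≤ 1

SortedBy : ∀ {a k} → (Fin k → Fin k → Set) → Word a k → Set
SortedBy {a} {k} _≺_ w =
  (w₁ w₂ w₃ : Word a k) (α β : Fin k) →
  w ≡ w₁ ++ (inj₂ α ∷ w₂) ++ (inj₂ β ∷ w₃) → α ≺ β

Oriented : ∀ {a k} → WordEquation a k → Set₁
Oriented {k = k} (L ≐ R) =
  Σ (Fin k → Fin k → Set) λ _≺_ →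
    IsStrictTotalOrder _≡_ _≺_ × SortedBy _≺_ L × SortedBy _≺_ R

RegularOriented : ∀ {a k} → WordEquation a k → Set₁
RegularOriented e = Regular e × Oriented e

-- Solutions: a homomorphism (A ∪ V)* → A* fixing constants is determined
-- by the images of the variables.

Assignment : ℕ → ℕ → Set
Assignment a k = Fin k → List (Fin a)

apply : ∀ {a k} → Assignment a k → Word a k → List (Fin a)
apply σ [] = []
apply σ (inj₁ c ∷ w) = c ∷ apply σ w
apply σ (inj₂ x ∷ w) = σ x ++ apply σ w

IsSolution : ∀ {a k} → Assignment a k → WordEquation a k → Set
IsSolution σ (L ≐ R) = apply σ L ≡ apply σ R

record DFA (a : ℕ) : Set where
  field
    nStates : ℕ
    start   : Fin nStates
    δ       : Fin nStates → Fin a → Fin nStates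
    final   : Fin nStates → Bool

run : ∀ {a} (M : DFA a) → Fin (DFA.nStates M) → List (Fin a) → Fin (DFA.nStates M)
run M q [] = q
run M q (c ∷ w) = run M (DFA.δ M q c) w

Accepts : ∀ {a} → DFA a → List (Fin a) → Set
Accepts M w = DFA.final M (run M (DFA.start M) w) ≡ true

RegConstraint : ℕ → ℕ → Set
RegConstraint a k = Fin k × DFA a

Satisfies : ∀ {a k} → Assignment a k → RegConstraint a k → Set
Satisfies σ (x , M) = Accepts M (σ x)

LengthAbstraction : ∀ {a k} → WordEquation a k → List (RegConstraint a k) →
                    (Fin k → ℕ) → Set
LengthAbstraction e S v =
  ∃ λ σ → IsSolution σ e × All (Satisfies σ) S × (∀ i → length (σ i) ≡ v i)

-- Presburger arithmetic: first-order formulas over (ℕ, 0, 1, +, ≤, =)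
-- with free variables Fin n (de Bruijn style).

data Term (n : ℕ) : Set where
  var  : Fin n → Term n
  zer  : Term n
  one  : Term n
  _⊕_  : Term n → Term n → Term n

data Formula (n : ℕ) : Set where
  _≤ₜ_ : Term n → Term n → Formula n
  _≡ₜ_ : Term n → Term n → Formula n
  ⊤ᶠ   : Formula n
  ⊥ᶠ   : Formula n
  ¬ᶠ_  : Formula n → Formula n
  _∧ᶠ_ : Formula n → Formula n → Formula n
  _∨ᶠ_ : Formula n → Formula n → Formula n
  _⇒ᶠ_ : Formula n → Formula n → Formula n
  ∃ᶠ   : Formula (suc n) → Formula n
  ∀ᶠ   : Formula (suc n) → Formula n

extend : ∀ {n} → ℕ → (Fin n → ℕ) → Fin (suc n) → ℕ
extend m ρ zero = m
extend m ρ (suc i) = ρ i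

⟦_⟧ₜ : ∀ {n} → Term n → (Fin n → ℕ) → ℕ
⟦ var i ⟧ₜ ρ = ρ i
⟦ zer ⟧ₜ ρ = 0
⟦ one ⟧ₜ ρ = 1
⟦ s ⊕ t ⟧ₜ ρ = ⟦ s ⟧ₜ ρ + ⟦ t ⟧ₜ ρ

open import Data.Empty using (⊥)
open import Data.Unit using (⊤)

⟦_⟧ : ∀ {n} → Formula n → (Fin n → ℕ) → Set
⟦ s ≤ₜ t ⟧ ρ = ⟦ s ⟧ₜ ρ ≤ ⟦ t ⟧ₜ ρ
⟦ s ≡ₜ t ⟧ ρ = ⟦ s ⟧ₜ ρ ≡ ⟦ t ⟧ₜ ρ
⟦ ⊤ᶠ ⟧ ρ = ⊤
⟦ ⊥ᶠ ⟧ ρ = ⊥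
⟦ ¬ᶠ φ ⟧ ρ = ¬ ⟦ φ ⟧ ρ
⟦ φ ∧ᶠ ψ ⟧ ρ = ⟦ φ ⟧ ρ × ⟦ ψ ⟧ ρ
⟦ φ ∨ᶠ ψ ⟧ ρ = ⟦ φ ⟧ ρ ⊎ ⟦ ψ ⟧ ρ
⟦ φ ⇒ᶠ ψ ⟧ ρ = ⟦ φ ⟧ ρ → ⟦ ψ ⟧ ρ
⟦ ∃ᶠ φ ⟧ ρ = ∃ λ m → ⟦ φ ⟧ (extend m ρ)
⟦ ∀ᶠ φ ⟧ ρ = ∀ m → ⟦ φ ⟧ (extend m ρ)

PresburgerDefinable : ∀ {n} → ((Fin n → ℕ) → Set) → Set
PresburgerDefinable {n} P = ∃ λ (φ : Formula n) → ∀ ρ → (⟦ φ ⟧ ρ ⇔ P ρ)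

module Submission where

-- Take the equation xy = yz with x ∈ a*b and y ∈ ε + (a+b)*b. Since x = aʳb is
-- primitive, solutions have y = xᴷ and z = x, so the length abstraction contains
-- every triple (n, Kn, n) with n ≥ 1, and |x| divides |y| in each of its triples.
-- Presburger-definable sets are automatic (Büchi): the binary expansions of their
-- members, least significant bit first, form a regular language. An adder with a
-- carry state handles the atomic formulas, and products, complementation and a
-- subset construction handle connectives and quantifiers. No automatic set lies
-- between the two divisibility bounds: of the prefixes encoding (d, 0, d) for the
-- M + 1 odd d in [2D, 4D), D = 2ᴹ, two reach the same state of an M-state
-- automaton; a suffix setting y to 2ᴸd₁ makes the first word accepted, hence the
-- second, so d₂ ∣ 2ᴸd₁, so d₂ ∣ d₁, impossible for distinct odd d in [2D, 4D).

open import Defs hiding (run; Accepts)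
open import Data.Nat using (ℕ; zero; suc; _+_; _*_; _^_; _∸_; _⊓_; _≤_; _<_; _≤?_; z≤n; s≤s; ⌊_/2⌋)
open import Data.Nat.Properties
open import Data.Nat.Tactic.RingSolver using (solve-∀)
open import Data.Nat.Divisibility using (_∣_; divides; _∣0; ∣-refl; ∣m∣n⇒∣m+n)
open import Data.Nat.Coprimality using (Coprime; coprime-divisor; coprime-+; 1-coprimeTo)
open import Data.Fin using (Fin; zero; suc; toℕ) renaming (_<_ to _<ᶠ_)
open import Data.Fin.Patterns using (0F; 1F; 2F)
open import Data.Fin.Properties using (*↔×; 1↔⊤; 2↔Bool; pigeonhole; toℕ≤pred[n]; any?)
  renaming (_≟_ to _≟ᶠ_; <-isStrictTotalOrder to <ᶠ-isStrictTotalOrder)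
open import Data.Fin.Subset using (Subset)
open import Data.Vec using ([]; _∷_; lookup; tabulate; uncons)
open import Data.Vec.Properties using (lookup∘tabulate)
open import Data.Vec.Functional using () renaming (_∷_ to _◂_)
open import Data.Bool using (Bool; true; false; T; not; _∧_; _∨_; _xor_)
open import Data.Bool.Properties using (T-∧; T-∨) renaming (_≟_ to _≟ᵇ_)
open import Data.List using (List; []; _∷_; _++_; [_]; length; map; foldl; take; drop; zipWith; replicate)
open import Data.List.Properties
  using (++-assoc; ++-identityʳ; ++-cancelˡ; ∷-injective; length-++; length-replicate; length-map; length-take;
         length-drop; take++drop≡id; map-++; map-∘; foldl-++; foldl-map)
open import Data.List.Relation.Unary.All using (_∷_; [])
open import Data.Product using (Σ; ∃; _×_; _,_; proj₁; proj₂; uncurry)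
open import Data.Product.Function.NonDependent.Propositional using (_×-⇔_; _×-↔_)
open import Data.Sum using (_⊎_; inj₁; inj₂)
open import Data.Sum.Function.Propositional using (_⊎-⇔_)
open import Data.Unit using (⊤; tt)
open import Data.Empty using (⊥; ⊥-elim)
open import Data.Maybe using (Maybe; just; nothing)
open import Function using (_∘_; case_of_)
open import Function.Bundles using (_⇔_; mk⇔; _↔_; mk↔ₛ′; Inverse; Equivalence)
open import Function.Properties.Equivalence using () renaming (trans to ⇔-trans; sym to ⇔-sym)
open import Function.Properties.Inverse using (↔-trans; ↔-sym)
open import Function.Related.TypeIsomorphisms using (→-cong-⇔; ¬-cong-⇔)
open import Relation.Nullary using (¬_; Dec; yes; no)
import Relation.Nullary.Decidable as Dec
open import Relation.Nullary.Decidable using (T?; _⊎-dec_; _×-dec_)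
open import Relation.Binary.PropositionalEquality hiding ([_])

-- Binary encodings

bit : Bool → ℕ
bit false = 0
bit true  = 1

fromBits : List Bool → ℕ
fromBits []       = 0
fromBits (b ∷ bs) = bit b + 2 * fromBits bs

bit+2*-injective : ∀ b c m n → bit b + 2 * m ≡ bit c + 2 * n → b ≡ c × m ≡ n
bit+2*-injective false false m n eq = refl , *-cancelˡ-≡ m n 2 eq
bit+2*-injective true  true  m n eq = refl , *-cancelˡ-≡ m n 2 (suc-injective eq)
bit+2*-injective false true  m n eq = ⊥-elim (even≢odd m n eq)
bit+2*-injective true  false m n eq = ⊥-elim (even≢odd n m (sym eq))

fromBits-++ : ∀ xs ys → fromBits (xs ++ ys) ≡ fromBits xs + 2 ^ length xs * fromBits ys
fromBits-++ []       ys = sym (+-identityʳ (fromBits ys))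
fromBits-++ (b ∷ xs) ys = trans (cong (λ v → bit b + 2 * v) (fromBits-++ xs ys))
                                (shift (bit b) (fromBits xs) (2 ^ length xs) (fromBits ys))
  where
  shift : ∀ x v p y → x + 2 * (v + p * y) ≡ (x + 2 * v) + 2 * p * y
  shift = solve-∀

lsb : ℕ → Bool
lsb zero          = false
lsb (suc zero)    = true
lsb (suc (suc n)) = lsb n

bit-lsb+2*⌊n/2⌋ : ∀ n → bit (lsb n) + 2 * ⌊ n /2⌋ ≡ n
bit-lsb+2*⌊n/2⌋ zero          = refl
bit-lsb+2*⌊n/2⌋ (suc zero)    = refl
bit-lsb+2*⌊n/2⌋ (suc (suc n)) = trans (two-more (bit (lsb n)) ⌊ n /2⌋) (cong (2 +_) (bit-lsb+2*⌊n/2⌋ n))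
  where
  two-more : ∀ x h → x + 2 * suc h ≡ 2 + (x + 2 * h)
  two-more = solve-∀

⌊n/2⌋<2^ : ∀ n L → n < 2 ^ suc L → ⌊ n /2⌋ < 2 ^ L
⌊n/2⌋<2^ n L n<2^1+L = *-cancelˡ-< 2 ⌊ n /2⌋ (2 ^ L) (begin-strict
  2 * ⌊ n /2⌋                ≤⟨ m≤n+m _ (bit (lsb n)) ⟩
  bit (lsb n) + 2 * ⌊ n /2⌋  ≡⟨ bit-lsb+2*⌊n/2⌋ n ⟩
  n                          <⟨ n<2^1+L ⟩
  2 ^ suc L                  ∎)
  where open ≤-Reasoning

n<2^n : ∀ n → n < 2 ^ n
n<2^n zero    = s≤s z≤n
n<2^n (suc n) = begin-strict
  suc n           ≡⟨ +-comm 1 n ⟩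
  n + 1           <⟨ +-mono-<-≤ (n<2^n n) (m^n>0 2 n) ⟩
  2 ^ n + 2 ^ n   ≡⟨ cong (2 ^ n +_) (sym (+-identityʳ (2 ^ n))) ⟩
  2 ^ suc n       ∎
  where open ≤-Reasoning

toBits : ℕ → ℕ → List Bool
toBits zero    n = []
toBits (suc L) n = lsb n ∷ toBits L ⌊ n /2⌋

length-toBits : ∀ L n → length (toBits L n) ≡ L
length-toBits zero    n = refl
length-toBits (suc L) n = cong suc (length-toBits L ⌊ n /2⌋)

fromBits-toBits : ∀ L n → n < 2 ^ L → fromBits (toBits L n) ≡ n
fromBits-toBits zero    n n<1 = sym (n<1⇒n≡0 n<1)
fromBits-toBits (suc L) n n<2^L =
  trans (cong (λ v → bit (lsb n) + 2 * v) (fromBits-toBits L ⌊ n /2⌋ (⌊n/2⌋<2^ n L n<2^L)))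
        (bit-lsb+2*⌊n/2⌋ n)

-- A word over Letter n spells n numbers in binary, least significant bit first,
-- one track per number; trailing zero letters do not change them.
Letter : ℕ → Set
Letter n = Fin n → Bool

track : ∀ {n} → Fin n → List (Letter n) → List Bool
track i = map (λ l → l i)

decode : ∀ {n} → List (Letter n) → Fin n → ℕ
decode w i = fromBits (track i w)

decode-++ : ∀ {n} (u v : List (Letter n)) i → decode (u ++ v) i ≡ decode u i + 2 ^ length u * decode v i
decode-++ u v i = begin
  fromBits (track i (u ++ v))                       ≡⟨ cong fromBits (map-++ _ u v) ⟩
  fromBits (track i u ++ track i v)                 ≡⟨ fromBits-++ (track i u) (track i v) ⟩
  decode u i + 2 ^ length (track i u) * decode v i  ≡⟨ cong (λ k → decode u i + 2 ^ k * decode v i) (length-map _ u) ⟩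
  decode u i + 2 ^ length u * decode v i            ∎
  where open ≡-Reasoning

_Represents_ : ∀ {n} → List (Letter n) → (Fin n → ℕ) → Set
w Represents ρ = ∀ i → decode w i ≡ ρ i

encode : ∀ {n} → ℕ → (Fin n → ℕ) → List (Letter n)
encode zero    ρ = []
encode (suc L) ρ = (λ i → lsb (ρ i)) ∷ encode L (λ i → ⌊ ρ i /2⌋)

track-encode : ∀ {n} L (ρ : Fin n → ℕ) i → track i (encode L ρ) ≡ toBits L (ρ i)
track-encode zero    ρ i = refl
track-encode (suc L) ρ i = cong (lsb (ρ i) ∷_) (track-encode L (λ j → ⌊ ρ j /2⌋) i)

length-encode : ∀ {n} L (ρ : Fin n → ℕ) → length (encode L ρ) ≡ L
length-encode zero    ρ = refl
length-encode (suc L) ρ = cong suc (length-encode L (λ j → ⌊ ρ j /2⌋))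

decode-encode : ∀ {n} L (ρ : Fin n → ℕ) i → ρ i < 2 ^ L → decode (encode L ρ) i ≡ ρ i
decode-encode L ρ i ρi<2^L = trans (cong fromBits (track-encode L ρ i)) (fromBits-toBits L (ρ i) ρi<2^L)

encode-++-encode : ∀ {n} L L′ (ρ σ : Fin n → ℕ) → (∀ i → ρ i < 2 ^ L) → (∀ i → σ i < 2 ^ L′) →
                   (encode L ρ ++ encode L′ σ) Represents (λ i → ρ i + 2 ^ L * σ i)
encode-++-encode L L′ ρ σ ρ<2^L σ<2^L′ i = begin
  decode (u ++ v) i                       ≡⟨ decode-++ u v i ⟩
  decode u i + 2 ^ length u * decode v i  ≡⟨ cong₂ (λ x k → x + 2 ^ k * decode v i)
                                                   (decode-encode L ρ i (ρ<2^L i)) (length-encode L ρ) ⟩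
  ρ i + 2 ^ L * decode v i                ≡⟨ cong (λ y → ρ i + 2 ^ L * y) (decode-encode L′ σ i (σ<2^L′ i)) ⟩
  ρ i + 2 ^ L * σ i                       ∎
  where
  open ≡-Reasoning
  u = encode L ρ
  v = encode L′ σ

2^-bound : ∀ {n} (ρ : Fin n → ℕ) → ∃ λ L → ∀ i → ρ i < 2 ^ L
2^-bound {zero}  ρ = 0 , λ ()
2^-bound {suc n} ρ with 2^-bound (λ i → ρ (suc i))
... | L , bound = ρ zero + L , λ where
  zero    → <-≤-trans (n<2^n (ρ zero)) (^-monoʳ-≤ 2 (m≤m+n (ρ zero) L))
  (suc i) → <-≤-trans (bound i) (^-monoʳ-≤ 2 (m≤n+m L (ρ zero)))

-- Finite automata

T-not : ∀ {x} → T (not x) ⇔ (¬ T x)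
T-not {false} = mk⇔ (λ _ ()) (λ _ → tt)
T-not {true}  = mk⇔ (λ ()) (λ ¬⊤ → ¬⊤ tt)

T-not-∨ : ∀ {x y} → T (not x ∨ y) ⇔ (T x → T y)
T-not-∨ {false}        = mk⇔ (λ _ ()) (λ _ → tt)
T-not-∨ {true} {true}  = mk⇔ (λ _ _ → tt) (λ _ → tt)
T-not-∨ {true} {false} = mk⇔ (λ ()) (λ f → f tt)

record Automaton (A : Set) : Set₁ where
  field
    State     : Set
    size      : ℕ
    finite    : State ↔ Fin size
    start     : State
    step      : State → A → State
    accepting : State → Bool

  index : State → Fin size
  index = Inverse.to finite

  state : Fin size → State
  state = Inverse.from finite

  state-index : ∀ q → state (index q) ≡ q
  state-index = Inverse.strictlyInverseʳ finite

  index-state : ∀ i → index (state i) ≡ i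
  index-state = Inverse.strictlyInverseˡ finite

  index-injective : ∀ {p q} → index p ≡ index q → p ≡ q
  index-injective {p} {q} eq = trans (sym (state-index p)) (trans (cong state eq) (state-index q))

  run : State → List A → State
  run = foldl step

  AcceptsFrom : State → List A → Set
  AcceptsFrom q w = T (accepting (run q w))

  Accepts : List A → Set
  Accepts = AcceptsFrom start

open Automaton using (AcceptsFrom; Accepts)

same-state-same-future : ∀ {A} (M : Automaton A) {q} u u′ w → Automaton.run M q u ≡ Automaton.run M q u′ →
                         AcceptsFrom M q (u ++ w) → AcceptsFrom M q (u′ ++ w)
same-state-same-future M {q} u u′ w same acc =
  subst (T ∘ M.accepting)
        (trans (foldl-++ M.step q u w) (trans (cong (λ p → M.run p w) same) (sym (foldl-++ M.step q u′ w))))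
        acc
  where module M = Automaton M

complement : ∀ {A} → Automaton A → Automaton A
complement M = record M { accepting = not ∘ Automaton.accepting M }

comap : ∀ {A B} → (B → A) → Automaton A → Automaton B
comap g M = record
  { State = M.State ; size = M.size ; finite = M.finite ; start = M.start
  ; step = λ q b → M.step q (g b) ; accepting = M.accepting }
  where module M = Automaton M

run-comap : ∀ {A B} (g : B → A) (M : Automaton A) q w →
            Automaton.run (comap g M) q w ≡ Automaton.run M q (map g w)
run-comap g M q w = sym (foldl-map (Automaton.step M) g q w)

product : ∀ {A} → (Bool → Bool → Bool) → Automaton A → Automaton A → Automaton A
product f M N = record
  { State     = M.State × N.State
  ; size      = M.size * N.size
  ; finite    = ↔-trans (M.finite ×-↔ N.finite) (↔-sym *↔×)
  ; start     = M.start , N.start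
  ; step      = λ { (p , q) a → M.step p a , N.step q a }
  ; accepting = λ { (p , q) → f (M.accepting p) (N.accepting q) }
  }
  where
  module M = Automaton M
  module N = Automaton N

run-product : ∀ {A} f (M N : Automaton A) p q w →
              Automaton.run (product f M N) (p , q) w ≡ (Automaton.run M p w , Automaton.run N q w)
run-product f M N p q []      = refl
run-product f M N p q (a ∷ w) = run-product f M N (Automaton.step M p a) (Automaton.step N q a) w

constant : ∀ {A} → Bool → Automaton A
constant b = record
  { State = ⊤ ; size = 1 ; finite = ↔-sym 1↔⊤ ; start = tt ; step = λ _ _ → tt ; accepting = λ _ → b }

-- Quantifying over all representations makes acceptance independent of trailing
-- zero letters, which the projection below relies on.
record Automatic (n : ℕ) (P : (Fin n → ℕ) → Set) : Set₁ where
  field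
    automaton  : Automaton (Letter n)
    recognises : ∀ w {ρ} → w Represents ρ → Accepts automaton w ⇔ P ρ

open Automatic

module _ {n : ℕ} where

  private
    Pred : Set₁
    Pred = (Fin n → ℕ) → Set

  Automatic-resp-⇔ : ∀ {P Q : Pred} → (∀ ρ → P ρ ⇔ Q ρ) → Automatic n P → Automatic n Q
  Automatic-resp-⇔ P⇔Q a = record
    { automaton = automaton a
    ; recognises = λ w {ρ} w↦ρ → ⇔-trans (recognises a w w↦ρ) (P⇔Q ρ) }

  Automatic-¬ : ∀ {P : Pred} → Automatic n P → Automatic n (λ ρ → ¬ P ρ)
  Automatic-¬ a = record
    { automaton = complement (automaton a)
    ; recognises = λ w w↦ρ → ⇔-trans T-not (¬-cong-⇔ (recognises a w w↦ρ)) }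

  Automatic-combine : ∀ {P Q : Pred} (f : Bool → Bool → Bool) (_⊙_ : Set → Set → Set) →
    (∀ {x y} → T (f x y) ⇔ (T x ⊙ T y)) →
    (∀ {A A′ B B′} → A ⇔ A′ → B ⇔ B′ → (A ⊙ B) ⇔ (A′ ⊙ B′)) →
    Automatic n P → Automatic n Q → Automatic n (λ ρ → P ρ ⊙ Q ρ)
  Automatic-combine f _⊙_ T-f ⊙-cong a b = record
    { automaton  = M×N
    ; recognises = λ w w↦ρ → correct w (⇔-trans T-f (⊙-cong (recognises a w w↦ρ) (recognises b w w↦ρ))) }
    where
    M = automaton a
    N = automaton b
    M×N = product f M N
    correct : ∀ w {S} → T (f (Automaton.accepting M (Automaton.run M (Automaton.start M) w))
                            (Automaton.accepting N (Automaton.run N (Automaton.start N) w))) ⇔ S →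
              Accepts M×N w ⇔ S
    correct w rewrite run-product f M N (Automaton.start M) (Automaton.start N) w = λ e → e

  Automatic-× : ∀ {P Q : Pred} → Automatic n P → Automatic n Q → Automatic n (λ ρ → P ρ × Q ρ)
  Automatic-× = Automatic-combine _∧_ _×_ T-∧ _×-⇔_

  Automatic-⊎ : ∀ {P Q : Pred} → Automatic n P → Automatic n Q → Automatic n (λ ρ → P ρ ⊎ Q ρ)
  Automatic-⊎ = Automatic-combine _∨_ _⊎_ T-∨ _⊎-⇔_

  Automatic-→ : ∀ {P Q : Pred} → Automatic n P → Automatic n Q → Automatic n (λ ρ → P ρ → Q ρ)
  Automatic-→ = Automatic-combine (λ x y → not x ∨ y) (λ A B → A → B) T-not-∨ →-cong-⇔

  Automatic-⊤ : Automatic n (λ _ → ⊤)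
  Automatic-⊤ = record { automaton = constant true ; recognises = λ _ _ → mk⇔ (λ _ → tt) (λ _ → tt) }

  Automatic-⊥ : Automatic n (λ _ → ⊥)
  Automatic-⊥ = record { automaton = constant false ; recognises = λ _ _ → mk⇔ (λ ()) (λ ()) }

  Automatic-rename : ∀ {m} {P : (Fin m → ℕ) → Set} (π : Fin m → Fin n) →
                     Automatic m P → Automatic n (λ ρ → P (ρ ∘ π))
  Automatic-rename {P = P} π a = record { automaton = comap rename M ; recognises = correct }
    where
    M = automaton a
    rename : Letter n → Letter _
    rename l = l ∘ π
    correct : ∀ w {ρ} → w Represents ρ → Accepts (comap rename M) w ⇔ P (ρ ∘ π)
    correct w w↦ρ rewrite run-comap rename M (Automaton.start M) w =
      recognises a (map rename w) (λ i → trans (cong fromBits (sym (map-∘ w))) (w↦ρ (π i)))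

module _ {A : Set} (M : Automaton A) where

  private module M = Automaton M

  loop-removal : ∀ q w → M.size < length w → ∃ λ w′ → length w′ < length w × M.run q w′ ≡ M.run q w
  loop-removal q w size<|w| with pigeonhole (n<1+n M.size) (λ i → M.index (M.run q (take (toℕ i) w)))
  ... | i , j , i<j , same-index = take (toℕ i) w ++ drop (toℕ j) w , shorter , same-state
    where
    j≤|w| : toℕ j ≤ length w
    j≤|w| = ≤-trans (toℕ≤pred[n] j) (<⇒≤ size<|w|)
    shorter : length (take (toℕ i) w ++ drop (toℕ j) w) < length w
    shorter = begin-strict
      length (take (toℕ i) w ++ drop (toℕ j) w)          ≡⟨ length-++ (take (toℕ i) w) ⟩
      length (take (toℕ i) w) + length (drop (toℕ j) w)  ≡⟨ cong₂ _+_ (length-take (toℕ i) w) (length-drop (toℕ j) w) ⟩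
      toℕ i ⊓ length w + (length w ∸ toℕ j)              ≡⟨ cong (_+ (length w ∸ toℕ j))
                                                                 (m≤n⇒m⊓n≡m (≤-trans (<⇒≤ i<j) j≤|w|)) ⟩
      toℕ i + (length w ∸ toℕ j)                         <⟨ +-monoˡ-< (length w ∸ toℕ j) i<j ⟩
      toℕ j + (length w ∸ toℕ j)                         ≡⟨ m+[n∸m]≡n j≤|w| ⟩
      length w                                           ∎
      where open ≤-Reasoning
    same-state : M.run q (take (toℕ i) w ++ drop (toℕ j) w) ≡ M.run q w
    same-state = begin
      M.run q (take (toℕ i) w ++ drop (toℕ j) w)         ≡⟨ foldl-++ M.step q (take (toℕ i) w) (drop (toℕ j) w) ⟩
      M.run (M.run q (take (toℕ i) w)) (drop (toℕ j) w)  ≡⟨ cong (λ p → M.run p (drop (toℕ j) w))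
                                                                 (M.index-injective same-index) ⟩
      M.run (M.run q (take (toℕ j) w)) (drop (toℕ j) w)  ≡⟨ foldl-++ M.step q (take (toℕ j) w) (drop (toℕ j) w) ⟨
      M.run q (take (toℕ j) w ++ drop (toℕ j) w)         ≡⟨ cong (M.run q) (take++drop≡id (toℕ j) w) ⟩
      M.run q w                                          ∎
      where open ≡-Reasoning

  short-accepted-word : ∀ k q w → length w ≤ k → AcceptsFrom M q w →
                        ∃ λ w′ → length w′ ≤ M.size × AcceptsFrom M q w′
  short-accepted-word k q w |w|≤k acc with length w ≤? M.size
  ... | yes short = w , short , acc
  short-accepted-word zero    q w |w|≤0   acc | no long = ⊥-elim (long (≤-trans |w|≤0 z≤n))
  short-accepted-word (suc k) q w |w|≤1+k acc | no long with loop-removal q w (≰⇒> long)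
  ... | w′ , shorter , same = short-accepted-word k q w′ (≤-pred (≤-trans shorter |w|≤1+k))
                                (subst (T ∘ M.accepting) (sym same) acc)

module _ (M : Automaton Bool) where

  private module M = Automaton M

  accepts-within? : ∀ k q → Dec (∃ λ bs → length bs ≤ k × AcceptsFrom M q bs)
  accepts-within? zero    q = Dec.map (mk⇔ (λ acc → [] , z≤n , acc) λ { ([] , _ , acc) → acc }) (T? (M.accepting q))
  accepts-within? (suc k) q = Dec.map (mk⇔ to from)
    (T? (M.accepting q) ⊎-dec accepts-within? k (M.step q false) ⊎-dec accepts-within? k (M.step q true))
    where
    to : _ → ∃ λ bs → length bs ≤ suc k × AcceptsFrom M q bs
    to (inj₁ acc)                     = [] , z≤n , acc
    to (inj₂ (inj₁ (bs , |bs|≤k , acc))) = false ∷ bs , s≤s |bs|≤k , acc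
    to (inj₂ (inj₂ (bs , |bs|≤k , acc))) = true ∷ bs , s≤s |bs|≤k , acc
    from : (∃ λ bs → length bs ≤ suc k × AcceptsFrom M q bs) → _
    from ([]         , _          , acc) = inj₁ acc
    from (false ∷ bs , s≤s |bs|≤k , acc) = inj₂ (inj₁ (bs , |bs|≤k , acc))
    from (true ∷ bs  , s≤s |bs|≤k , acc) = inj₂ (inj₂ (bs , |bs|≤k , acc))

  nonempty? : ∀ q → Dec (∃ λ bs → AcceptsFrom M q bs)
  nonempty? q = Dec.map (mk⇔ (λ (bs , _ , acc) → bs , acc)
                             (λ (bs , acc) → short-accepted-word M (length bs) q bs ≤-refl acc))
                        (accepts-within? M.size q)

Subset↔Fin2^ : ∀ m → Subset m ↔ Fin (2 ^ m)
Subset↔Fin2^ zero    = mk↔ₛ′ (λ _ → zero) (λ _ → []) (λ { zero → refl }) (λ { [] → refl })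
Subset↔Fin2^ (suc m) = ↔-trans Vec↔× (↔-trans (↔-sym 2↔Bool ×-↔ Subset↔Fin2^ m) (↔-sym *↔×))
  where
  Vec↔× : Subset (suc m) ↔ (Bool × Subset m)
  Vec↔× = mk↔ₛ′ uncons (uncurry _∷_) (λ _ → refl) (λ { (_ ∷ _) → refl })

decideSubset : ∀ {m} {P : Fin m → Set} → (∀ t → Dec (P t)) → Subset m
decideSubset P? = tabulate (λ t → Dec.⌊ P? t ⌋)

∈-decideSubset : ∀ {m} {P : Fin m → Set} (P? : ∀ t → Dec (P t)) t → T (lookup (decideSubset P?) t) ⇔ P t
∈-decideSubset P? t rewrite lookup∘tabulate (λ t → Dec.⌊ P? t ⌋) t = mk⇔ Dec.toWitness Dec.fromWitness

any-Bool? : {P : Bool → Set} → (∀ b → Dec (P b)) → Dec (∃ P)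
any-Bool? P? = Dec.map (mk⇔ (λ { (inj₁ p) → false , p ; (inj₂ p) → true , p })
                            (λ { (false , p) → inj₁ p ; (true , p) → inj₂ p }))
                       (P? false ⊎-dec P? true)

module _ {n : ℕ} where

  addTrack : List Bool → List (Letter n) → List (Letter (suc n))
  addTrack = zipWith _◂_

  lowLetter : Bool → Letter (suc n)
  lowLetter b = b ◂ λ _ → false

  track-zero-addTrack : ∀ bs w → length bs ≡ length w → track zero (addTrack bs w) ≡ bs
  track-zero-addTrack []       []      _   = refl
  track-zero-addTrack (b ∷ bs) (l ∷ w) len = cong (b ∷_) (track-zero-addTrack bs w (suc-injective len))

  track-suc-addTrack : ∀ bs w i → length bs ≡ length w → track (suc i) (addTrack bs w) ≡ track i w
  track-suc-addTrack []       []      i _   = refl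
  track-suc-addTrack (b ∷ bs) (l ∷ w) i len = cong (l i ∷_) (track-suc-addTrack bs w i (suc-injective len))

  track-zero-lowLetters : ∀ cs → track zero (map lowLetter cs) ≡ cs
  track-zero-lowLetters []       = refl
  track-zero-lowLetters (c ∷ cs) = cong (c ∷_) (track-zero-lowLetters cs)

  decode-suc-lowLetters : ∀ cs i → decode (map lowLetter cs) (suc i) ≡ 0
  decode-suc-lowLetters []       i = refl
  decode-suc-lowLetters (c ∷ cs) i = cong (2 *_) (decode-suc-lowLetters cs i)

  addTrack-represents : ∀ {ρ} bs cs w → length bs ≡ length w → w Represents ρ →
                        (addTrack bs w ++ map lowLetter cs) Represents extend (fromBits (bs ++ cs)) ρ
  addTrack-represents bs cs w len w↦ρ zero = begin
    decode (u ++ v) zero                          ≡⟨ decode-++ u v zero ⟩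
    decode u zero + 2 ^ length u * decode v zero  ≡⟨ cong₂ (λ x y → fromBits x + 2 ^ length u * fromBits y)
                                                           (track-zero-addTrack bs w len) (track-zero-lowLetters cs) ⟩
    fromBits bs + 2 ^ length u * fromBits cs      ≡⟨ cong (λ k → fromBits bs + 2 ^ k * fromBits cs) |u|≡|bs| ⟩
    fromBits bs + 2 ^ length bs * fromBits cs     ≡⟨ fromBits-++ bs cs ⟨
    fromBits (bs ++ cs)                           ∎
    where
    open ≡-Reasoning
    u = addTrack bs w
    v = map lowLetter cs
    |u|≡|bs| : length u ≡ length bs
    |u|≡|bs| = trans (sym (length-map _ u)) (cong length (track-zero-addTrack bs w len))
  addTrack-represents {ρ} bs cs w len w↦ρ (suc i) = begin
    decode (u ++ v) (suc i)                             ≡⟨ decode-++ u v (suc i) ⟩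
    decode u (suc i) + 2 ^ length u * decode v (suc i)  ≡⟨ cong₂ (λ x y → fromBits x + 2 ^ length u * y)
                                                                 (track-suc-addTrack bs w i len) (decode-suc-lowLetters cs i) ⟩
    decode w i + 2 ^ length u * 0                       ≡⟨ cong (decode w i +_) (*-zeroʳ (2 ^ length u)) ⟩
    decode w i + 0                                      ≡⟨ +-identityʳ (decode w i) ⟩
    decode w i                                          ≡⟨ w↦ρ i ⟩
    ρ i                                                 ∎
    where
    open ≡-Reasoning
    u = addTrack bs w
    v = map lowLetter cs

module Projection {n : ℕ} {P : (Fin (suc n) → ℕ) → Set} (a : Automatic (suc n) P) where

  private
    M = automaton a
    module M = Automaton M

  Successor : Subset M.size → Letter n → Fin M.size → Set
  Successor S l t = ∃ λ s → T (lookup S s) × ∃ λ b → M.index (M.step (M.state s) (b ◂ l)) ≡ t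

  successor? : ∀ S l t → Dec (Successor S l t)
  successor? S l t =
    any? (λ s → T? (lookup S s) ×-dec any-Bool? (λ b → M.index (M.step (M.state s) (b ◂ l)) ≟ᶠ t))

  -- The new track is guessed letter by letter. The witness may need more digits
  -- than the word provides, so a subset accepts if one of its states still reaches
  -- acceptance on further letters that are zero outside the new track.
  subsetAutomaton : Automaton (Letter n)
  subsetAutomaton = record
    { State     = Subset M.size
    ; size      = 2 ^ M.size
    ; finite    = Subset↔Fin2^ M.size
    ; start     = decideSubset (λ t → M.index M.start ≟ᶠ t)
    ; step      = λ S l → decideSubset (successor? S l)
    ; accepting = λ S → Dec.⌊ any? (λ s → T? (lookup S s) ×-dec nonempty? (comap lowLetter M) (M.state s)) ⌋
    }

  private module S = Automaton subsetAutomaton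

  ReachableVia : Subset M.size → List (Letter n) → Fin M.size → Set
  ReachableVia S w t = ∃ λ s → T (lookup S s) ×
                       ∃ λ bs → length bs ≡ length w × M.index (M.run (M.state s) (addTrack bs w)) ≡ t

  run-subset-sound : ∀ S w t → T (lookup (S.run S w) t) → ReachableVia S w t
  run-subset-sound S []      t t∈S = t , t∈S , [] , refl , M.index-state t
  run-subset-sound S (l ∷ w) t t∈  with run-subset-sound (S.step S l) w t t∈
  ... | s′ , s′∈ , bs , len , reach with Equivalence.to (∈-decideSubset (successor? S l) s′) s′∈
  ... | s , s∈S , b , step-s≡s′ = s , s∈S , b ∷ bs , cong suc len ,
      trans (cong (λ q → M.index (M.run q (addTrack bs w)))
                  (trans (sym (M.state-index _)) (cong M.state step-s≡s′)))
            reach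

  run-subset-complete : ∀ S w s bs → T (lookup S s) → length bs ≡ length w →
                        T (lookup (S.run S w) (M.index (M.run (M.state s) (addTrack bs w))))
  run-subset-complete S []      s []       s∈S _   = subst (T ∘ lookup S) (sym (M.index-state s)) s∈S
  run-subset-complete S (l ∷ w) s (b ∷ bs) s∈S len =
    subst (λ q → T (lookup (S.run (S.step S l) w) (M.index (M.run q (addTrack bs w)))))
          (M.state-index _)
          (run-subset-complete (S.step S l) w s′ bs s′∈ (suc-injective len))
    where
    s′ = M.index (M.step (M.state s) (b ◂ l))
    s′∈ : T (lookup (S.step S l) s′)
    s′∈ = Equivalence.from (∈-decideSubset (successor? S l) s′) (s , s∈S , b , refl)

  completable⇔ : ∀ u cs → AcceptsFrom (comap lowLetter M) (M.run M.start u) cs ⇔ Accepts M (u ++ map lowLetter cs)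
  completable⇔ u cs = mk⇔ (subst (T ∘ M.accepting) same) (subst (T ∘ M.accepting) (sym same))
    where
    same : Automaton.run (comap lowLetter M) (M.run M.start u) cs ≡ M.run M.start (u ++ map lowLetter cs)
    same = trans (run-comap lowLetter M _ cs) (sym (foldl-++ M.step M.start u (map lowLetter cs)))

  sound : ∀ w {ρ} → w Represents ρ → Accepts subsetAutomaton w → ∃ λ K → P (extend K ρ)
  sound w {ρ} w↦ρ acc with Dec.toWitness acc
  ... | t , t∈ , cs , completes with run-subset-sound S.start w t t∈
  ... | s , s∈start , bs , len , reach =
    fromBits (bs ++ cs) ,
    Equivalence.to (recognises a (u ++ map lowLetter cs) (addTrack-represents bs cs w len w↦ρ))
                   (Equivalence.to (completable⇔ u cs)
                                   (subst (λ q → AcceptsFrom (comap lowLetter M) q cs) state-t completes))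
    where
    u = addTrack bs w
    start≡state-s : M.start ≡ M.state s
    start≡state-s = trans (sym (M.state-index M.start))
                          (cong M.state (Equivalence.to (∈-decideSubset (λ t → M.index M.start ≟ᶠ t) s) s∈start))
    state-t : M.state t ≡ M.run M.start u
    state-t = trans (cong M.state (sym reach))
                    (trans (M.state-index _) (cong (λ q → M.run q u) (sym start≡state-s)))

  complete : ∀ w {ρ} → w Represents ρ → (∃ λ K → P (extend K ρ)) → Accepts subsetAutomaton w
  complete w {ρ} w↦ρ (K , pK) = Dec.fromWitness (M.index r , r∈ , cs , completes)
    where
    B  = toBits (length w + K) K
    bs = take (length w) B
    cs = drop (length w) B
    u  = addTrack bs w
    r  = M.run M.start u
    |bs|≡|w| : length bs ≡ length w
    |bs|≡|w| = trans (length-take (length w) B)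
                     (trans (cong (length w ⊓_) (length-toBits (length w + K) K)) (m≤n⇒m⊓n≡m (m≤m+n (length w) K)))
    bs++cs≡K : fromBits (bs ++ cs) ≡ K
    bs++cs≡K = trans (cong fromBits (take++drop≡id (length w) B))
                     (fromBits-toBits (length w + K) K (<-≤-trans (n<2^n K) (^-monoʳ-≤ 2 (m≤n+m K (length w)))))
    completes : AcceptsFrom (comap lowLetter M) (M.state (M.index r)) cs
    completes = subst (λ q → AcceptsFrom (comap lowLetter M) q cs) (sym (M.state-index r))
      (Equivalence.from (completable⇔ u cs)
        (Equivalence.from (recognises a (u ++ map lowLetter cs) (addTrack-represents bs cs w |bs|≡|w| w↦ρ))
                          (subst (λ k → P (extend k ρ)) (sym bs++cs≡K) pK)))
    r∈ : T (lookup (S.run S.start w) (M.index r))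
    r∈ = subst (λ q → T (lookup (S.run S.start w) (M.index (M.run q u)))) (M.state-index M.start)
           (run-subset-complete S.start w (M.index M.start) bs
             (Equivalence.from (∈-decideSubset (λ t → M.index M.start ≟ᶠ t) _) refl) |bs|≡|w|)

Automatic-∃ : ∀ {n} {P : (Fin (suc n) → ℕ) → Set} →
              Automatic (suc n) P → Automatic n (λ ρ → ∃ λ K → P (extend K ρ))
Automatic-∃ a = record
  { automaton  = subsetAutomaton
  ; recognises = λ w w↦ρ → mk⇔ (sound w w↦ρ) (complete w w↦ρ) }
  where open Projection a

Automatic⇒Decidable : ∀ {n} {P : (Fin n → ℕ) → Set} → Automatic n P → ∀ ρ → Dec (P ρ)
Automatic⇒Decidable a ρ with 2^-bound ρ
... | L , bound = Dec.map (recognises a (encode L ρ) (λ i → decode-encode L ρ i (bound i))) (T? _)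

Automatic-∀ : ∀ {n} {P : (Fin (suc n) → ℕ) → Set} →
              Automatic (suc n) P → Automatic n (λ ρ → ∀ K → P (extend K ρ))
Automatic-∀ {P = P} a = Automatic-resp-⇔ ¬∃¬⇔∀ (Automatic-¬ (Automatic-∃ (Automatic-¬ a)))
  where
  ¬∃¬⇔∀ : ∀ ρ → (¬ ∃ λ K → ¬ P (extend K ρ)) ⇔ (∀ K → P (extend K ρ))
  ¬∃¬⇔∀ ρ = mk⇔
    (λ ¬∃¬ K → Dec.decidable-stable (Automatic⇒Decidable a (extend K ρ)) (λ ¬p → ¬∃¬ (K , ¬p)))
    (λ ∀p (K , ¬p) → ¬p (∀p K))

-- Presburger-definable predicates are automatic

carry : Bool → Bool → Bool → Bool
carry x y c = (x ∧ y) ∨ (c ∧ (x xor y))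

full-adder : ∀ x y c → bit x + bit y + bit c ≡ bit (x xor y xor c) + 2 * bit (carry x y c)
full-adder false false false = refl
full-adder false false true  = refl
full-adder false true  false = refl
full-adder false true  true  = refl
full-adder true  false false = refl
full-adder true  false true  = refl
full-adder true  true  false = refl
full-adder true  true  true  = refl

column-sum : ∀ x y c X Y → (bit x + 2 * X) + (bit y + 2 * Y) + bit c ≡
                           bit (x xor y xor c) + 2 * (X + Y + bit (carry x y c))
column-sum x y c X Y = begin
  (bit x + 2 * X) + (bit y + 2 * Y) + bit c                 ≡⟨ regroup (bit x) (bit y) (bit c) X Y ⟩
  (bit x + bit y + bit c) + 2 * (X + Y)                     ≡⟨ cong (_+ 2 * (X + Y)) (full-adder x y c) ⟩
  (bit (x xor y xor c) + 2 * bit (carry x y c)) + 2 * (X + Y) ≡⟨ carry-in (bit (x xor y xor c)) (bit (carry x y c)) X Y ⟩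
  bit (x xor y xor c) + 2 * (X + Y + bit (carry x y c))     ∎
  where
  open ≡-Reasoning
  regroup : ∀ a b c X Y → (a + 2 * X) + (b + 2 * Y) + c ≡ (a + b + c) + 2 * (X + Y)
  regroup = solve-∀
  carry-in : ∀ s k X Y → (s + 2 * k) + 2 * (X + Y) ≡ s + 2 * (X + Y + k)
  carry-in = solve-∀

Maybe-Bool↔Fin3 : Maybe Bool ↔ Fin 3
Maybe-Bool↔Fin3 = mk↔ₛ′ to from
  (λ { 0F → refl ; 1F → refl ; 2F → refl })
  (λ { nothing → refl ; (just false) → refl ; (just true) → refl })
  where
  to : Maybe Bool → Fin 3
  to nothing      = 0F
  to (just false) = 1F
  to (just true)  = 2F
  from : Fin 3 → Maybe Bool
  from 0F = nothing
  from 1F = just false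
  from 2F = just true

-- State just c carries c into the next column; nothing means a column sum was wrong.
adderStep : Maybe Bool → Letter 3 → Maybe Bool
adderStep nothing  l = nothing
adderStep (just c) l with l 0F xor l 1F xor c ≟ᵇ l 2F
... | yes _ = just (carry (l 0F) (l 1F) c)
... | no  _ = nothing

adderAccepting : Maybe Bool → Bool
adderAccepting (just false) = true
adderAccepting _            = false

adder : Bool → Automaton (Letter 3)
adder c = record
  { State = Maybe Bool ; size = 3 ; finite = Maybe-Bool↔Fin3
  ; start = just c ; step = adderStep ; accepting = adderAccepting }

adder-dead : ∀ c w → ¬ AcceptsFrom (adder c) nothing w
adder-dead c []      ()
adder-dead c (l ∷ w) = adder-dead c w

column-equation : ∀ c (l : Letter 3) w →
  (decode (l ∷ w) 0F + decode (l ∷ w) 1F + bit c ≡ decode (l ∷ w) 2F) ⇔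
  (l 0F xor l 1F xor c ≡ l 2F ×
   decode w 0F + decode w 1F + bit (carry (l 0F) (l 1F) c) ≡ decode w 2F)
column-equation c l w = mk⇔
  (λ e → bit+2*-injective (x xor y xor c) (l 2F) _ _ (trans (sym sum) e))
  (λ (s≡z , e) → trans sum (cong₂ (λ s k → bit s + 2 * k) s≡z e))
  where
  x = l 0F
  y = l 1F
  sum = column-sum x y c (decode w 0F) (decode w 1F)

adder-correct : ∀ c w → AcceptsFrom (adder c) (just c) w ⇔
                        (decode w 0F + decode w 1F + bit c ≡ decode w 2F)
adder-correct false []      = mk⇔ (λ _ → refl) (λ _ → tt)
adder-correct true  []      = mk⇔ (λ ()) (λ ())
adder-correct c     (l ∷ w) with l 0F xor l 1F xor c ≟ᵇ l 2F
... | yes s≡z = ⇔-trans (adder-correct (carry (l 0F) (l 1F) c) w)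
                        (⇔-trans (mk⇔ (s≡z ,_) proj₂) (⇔-sym (column-equation c l w)))
... | no  s≢z = mk⇔ (λ acc → ⊥-elim (adder-dead c w acc))
                    (λ e → ⊥-elim (s≢z (proj₁ (Equivalence.to (column-equation c l w) e))))

Automatic-+ : ∀ {n} c (i j k : Fin n) → Automatic n (λ ρ → ρ i + ρ j + bit c ≡ ρ k)
Automatic-+ c i j k = Automatic-rename (λ { 0F → i ; 1F → j ; 2F → k }) addition
  where
  addition : Automatic 3 (λ ρ → ρ 0F + ρ 1F + bit c ≡ ρ 2F)
  addition = record { automaton = adder c ; recognises = correct }
    where
    correct : ∀ w {ρ} → w Represents ρ → Accepts (adder c) w ⇔ (ρ 0F + ρ 1F + bit c ≡ ρ 2F)
    correct w w↦ρ rewrite sym (w↦ρ 0F) | sym (w↦ρ 1F) | sym (w↦ρ 2F) = adder-correct c w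

x+x+0≡x⇒x≡0 : ∀ x → x + x + 0 ≡ x → x ≡ 0
x+x+0≡x⇒x≡0 x eq = +-cancelˡ-≡ x x 0 (trans (sym (+-identityʳ (x + x))) (trans eq (sym (+-identityʳ x))))

x+0+0≡x : ∀ x → x + 0 + 0 ≡ x
x+0+0≡x x = trans (+-identityʳ (x + 0)) (+-identityʳ x)

Automatic-≡0 : ∀ {n} (i : Fin n) → Automatic n (λ ρ → ρ i ≡ 0)
Automatic-≡0 i = Automatic-resp-⇔
  (λ ρ → mk⇔ (x+x+0≡x⇒x≡0 (ρ i)) (λ ρi≡0 → subst (λ x → x + x + 0 ≡ x) (sym ρi≡0) refl))
  (Automatic-+ false i i i)

Automatic-≡ : ∀ {n} (i j : Fin n) → Automatic n (λ ρ → ρ i ≡ ρ j)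
Automatic-≡ i j = Automatic-resp-⇔
  (λ ρ → mk⇔ (λ { (_ , refl , e) → trans (sym (x+0+0≡x (ρ i))) e }) (λ e → 0 , refl , trans (x+0+0≡x (ρ i)) e))
  (Automatic-∃ (Automatic-× (Automatic-≡0 0F) (Automatic-+ false (suc i) 0F (suc j))))

AutomaticFunction : ∀ n → ((Fin n → ℕ) → ℕ) → Set₁
AutomaticFunction n f = Automatic (suc n) (λ ρ → f (ρ ∘ suc) ≡ ρ 0F)

AutomaticFunction-var : ∀ {n} (i : Fin n) → AutomaticFunction n (λ ρ → ρ i)
AutomaticFunction-var i = Automatic-≡ (suc i) 0F

AutomaticFunction-bit : ∀ {n} c → AutomaticFunction n (λ _ → bit c)
AutomaticFunction-bit c = Automatic-resp-⇔ (λ ρ → mk⇔ (λ { (_ , refl , e) → e }) (λ e → 0 , refl , e))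
  (Automatic-∃ (Automatic-× (Automatic-≡0 0F) (Automatic-+ c 0F 0F 1F)))

AutomaticFunction-weaken : ∀ {n f} → AutomaticFunction n f → AutomaticFunction (suc n) (λ ρ → f (ρ ∘ suc))
AutomaticFunction-weaken = Automatic-rename λ { 0F → 0F ; (suc i) → suc (suc i) }

AutomaticFunction-+ : ∀ {n f g} → AutomaticFunction n f → AutomaticFunction n g →
                      AutomaticFunction n (λ ρ → f ρ + g ρ)
AutomaticFunction-+ af ag = Automatic-resp-⇔
  (λ ρ → mk⇔ (λ { (_ , _ , refl , refl , e) → trans (sym (+-identityʳ _)) e })
             (λ e → _ , _ , refl , refl , trans (+-identityʳ _) e))
  (Automatic-∃ (Automatic-∃ (Automatic-×
    (Automatic-rename (λ { 0F → 1F ; (suc i) → suc (suc (suc i)) }) af) (Automatic-×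
    (Automatic-rename (λ { 0F → 0F ; (suc i) → suc (suc (suc i)) }) ag)
    (Automatic-+ false 1F 0F 2F)))))

Automatic-≡ᶠ : ∀ {n f g} → AutomaticFunction n f → AutomaticFunction n g → Automatic n (λ ρ → f ρ ≡ g ρ)
Automatic-≡ᶠ af ag = Automatic-resp-⇔ (λ ρ → mk⇔ (λ { (_ , e , e′) → trans e (sym e′) }) (λ e → _ , e , refl))
  (Automatic-∃ (Automatic-× af ag))

Automatic-≤ᶠ : ∀ {n f g} → AutomaticFunction n f → AutomaticFunction n g → Automatic n (λ ρ → f ρ ≤ g ρ)
Automatic-≤ᶠ {n} {f} {g} af ag = Automatic-resp-⇔
  (λ ρ → mk⇔ (λ (d , e) → subst (f ρ ≤_) e (m≤m+n (f ρ) d)) (λ f≤g → m≤n⇒∃[o]m+o≡n f≤g))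
  (Automatic-∃ f+d≡g)
  where
  f+d≡g : Automatic (suc n) (λ ρ → f (ρ ∘ suc) + ρ zero ≡ g (ρ ∘ suc))
  f+d≡g = Automatic-≡ᶠ (AutomaticFunction-+ {f = λ ρ → f (ρ ∘ suc)} {g = λ ρ → ρ zero}
                                           (AutomaticFunction-weaken {f = f} af) (AutomaticFunction-var zero))
                       (AutomaticFunction-weaken {f = g} ag)

term-automatic : ∀ {n} (t : Term n) → AutomaticFunction n ⟦ t ⟧ₜ
term-automatic (var i) = AutomaticFunction-var i
term-automatic zer     = AutomaticFunction-bit false
term-automatic one     = AutomaticFunction-bit true
term-automatic (s ⊕ t) = AutomaticFunction-+ {f = ⟦ s ⟧ₜ} {g = ⟦ t ⟧ₜ} (term-automatic s) (term-automatic t)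

formula-automatic : ∀ {n} (φ : Formula n) → Automatic n ⟦ φ ⟧
formula-automatic (s ≤ₜ t) = Automatic-≤ᶠ (term-automatic s) (term-automatic t)
formula-automatic (s ≡ₜ t) = Automatic-≡ᶠ (term-automatic s) (term-automatic t)
formula-automatic ⊤ᶠ       = Automatic-⊤
formula-automatic ⊥ᶠ       = Automatic-⊥
formula-automatic (¬ᶠ φ)   = Automatic-¬ (formula-automatic φ)
formula-automatic (φ ∧ᶠ ψ) = Automatic-× (formula-automatic φ) (formula-automatic ψ)
formula-automatic (φ ∨ᶠ ψ) = Automatic-⊎ (formula-automatic φ) (formula-automatic ψ)
formula-automatic (φ ⇒ᶠ ψ) = Automatic-→ (formula-automatic φ) (formula-automatic ψ)
formula-automatic (∃ᶠ φ)   = Automatic-∃ (formula-automatic φ)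
formula-automatic (∀ᶠ φ)   = Automatic-∀ (formula-automatic φ)

PresburgerDefinable⇒Automatic : ∀ {n} {P : (Fin n → ℕ) → Set} → PresburgerDefinable P → Automatic n P
PresburgerDefinable⇒Automatic (φ , φ⇔P) = Automatic-resp-⇔ φ⇔P (formula-automatic φ)

-- A predicate between two divisibility bounds is not automatic

pattern X = zero
pattern Y = suc zero
pattern Z = suc (suc zero)

odd∣2^*⇒∣ : ∀ e L n → suc (2 * e) ∣ 2 ^ L * n → suc (2 * e) ∣ n
odd∣2^*⇒∣ e zero    n d∣n     = subst (suc (2 * e) ∣_) (+-identityʳ n) d∣n
odd∣2^*⇒∣ e (suc L) n d∣2^1+L = odd∣2^*⇒∣ e L n
  (coprime-divisor (odd-coprime-2 e) (subst (suc (2 * e) ∣_) (*-assoc 2 (2 ^ L) n) d∣2^1+L))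
  where
  odd-coprime-2 : ∀ e → Coprime (suc (2 * e)) 2
  odd-coprime-2 zero    = 1-coprimeTo 2
  odd-coprime-2 (suc e) = subst (λ k → Coprime k 2) (sym (two-more e)) (coprime-+ (odd-coprime-2 e))
    where
    two-more : ∀ e → suc (2 * suc e) ≡ 2 + suc (2 * e)
    two-more = solve-∀

m∣n∧n<2*m⇒m≡n : ∀ m n → m ∣ n → 0 < n → n < 2 * m → m ≡ n
m∣n∧n<2*m⇒m≡n m n (divides zero          n≡0)       0<n _     = ⊥-elim (<-irrefl (sym n≡0) 0<n)
m∣n∧n<2*m⇒m≡n m n (divides (suc zero)    n≡1*m)     _   _     = sym (trans n≡1*m (+-identityʳ m))
m∣n∧n<2*m⇒m≡n m n (divides (suc (suc q)) n≡m+m+q*m) _   n<2*m = ⊥-elim (<⇒≱ n<2*m (begin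
  2 * m            ≡⟨ cong (m +_) (+-identityʳ m) ⟩
  m + m            ≤⟨ +-monoʳ-≤ m (m≤m+n m (q * m)) ⟩
  m + (m + q * m)  ≡⟨ n≡m+m+q*m ⟨
  n                ∎))
  where open ≤-Reasoning

⟨_,_,_⟩ : ℕ → ℕ → ℕ → Fin 3 → ℕ
⟨ x , y , z ⟩ X = x
⟨ x , y , z ⟩ Y = y
⟨ x , y , z ⟩ Z = z

module Pumping {P : (Fin 3 → ℕ) → Set}
         (P-∋ : ∀ r K v → v X ≡ suc r → v Y ≡ K * suc r → v Z ≡ suc r → P v)
         (P-⊆ : ∀ v → P v → v X ∣ v Y)
         (a : Automatic 3 P) where

  private
    M = automaton a
    module M = Automaton M
    D = 2 ^ M.size
    L = 2 + M.size

  d : Fin (suc M.size) → ℕ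
  d t = suc (2 * (D + toℕ t))

  2*D≤d : ∀ t → 2 * D ≤ d t
  2*D≤d t = ≤-trans (*-monoʳ-≤ 2 (m≤m+n D (toℕ t))) (n≤1+n _)

  d<2^L : ∀ t → d t < 2 ^ L
  d<2^L t = begin
    suc (d t)            ≡⟨ *-suc 2 (D + toℕ t) ⟨
    2 * suc (D + toℕ t)  ≤⟨ *-monoʳ-≤ 2 D+t<2*D ⟩
    2 * (2 * D)          ∎
    where
    open ≤-Reasoning
    D+t<2*D : D + toℕ t < 2 * D
    D+t<2*D = begin
      suc (D + toℕ t)  ≡⟨ +-suc D (toℕ t) ⟨
      D + suc (toℕ t)  ≤⟨ +-monoʳ-≤ D (<-≤-trans (s≤s (toℕ≤pred[n] t)) (n<2^n M.size)) ⟩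
      D + D            ≡⟨ cong (D +_) (+-identityʳ D) ⟨
      2 * D            ∎

  prefix : Fin (suc M.size) → List (Letter 3)
  prefix t = encode L ⟨ d t , 0 , d t ⟩

  word : Fin (suc M.size) → ℕ → List (Letter 3)
  word t c = prefix t ++ encode c ⟨ 0 , c , 0 ⟩

  word-represents : ∀ t c → word t c Represents ⟨ d t , 2 ^ L * c , d t ⟩
  word-represents t c i =
    trans (encode-++-encode L c ⟨ d t , 0 , d t ⟩ ⟨ 0 , c , 0 ⟩ prefix-bound suffix-bound i) (component i)
    where
    prefix-bound : ∀ i → ⟨ d t , 0 , d t ⟩ i < 2 ^ L
    prefix-bound X = d<2^L t
    prefix-bound Y = m^n>0 2 L
    prefix-bound Z = d<2^L t
    suffix-bound : ∀ i → ⟨ 0 , c , 0 ⟩ i < 2 ^ c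
    suffix-bound X = m^n>0 2 c
    suffix-bound Y = n<2^n c
    suffix-bound Z = m^n>0 2 c
    component : ∀ i → ⟨ d t , 0 , d t ⟩ i + 2 ^ L * ⟨ 0 , c , 0 ⟩ i ≡ ⟨ d t , 2 ^ L * c , d t ⟩ i
    component X = trans (cong (d t +_) (*-zeroʳ (2 ^ L))) (+-identityʳ (d t))
    component Y = refl
    component Z = trans (cong (d t +_) (*-zeroʳ (2 ^ L))) (+-identityʳ (d t))

  accepts-word⇔ : ∀ t c → Accepts M (word t c) ⇔ P ⟨ d t , 2 ^ L * c , d t ⟩
  accepts-word⇔ t c = recognises a (word t c) (word-represents t c)

  d-injective : ∀ {t t′} → d t ≡ d t′ → toℕ t ≡ toℕ t′
  d-injective {t} {t′} eq =
    +-cancelˡ-≡ D (toℕ t) (toℕ t′) (*-cancelˡ-≡ (D + toℕ t) (D + toℕ t′) 2 (suc-injective eq))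

  prefixes-reach-distinct-states : ∀ {t₁ t₂} → toℕ t₁ < toℕ t₂ →
                                   M.run M.start (prefix t₁) ≢ M.run M.start (prefix t₂)
  prefixes-reach-distinct-states {t₁} {t₂} t₁<t₂ same = <-irrefl (sym (d-injective d₂≡d₁)) t₁<t₂
    where
    in-P : P ⟨ d t₂ , 2 ^ L * d t₁ , d t₂ ⟩
    in-P = Equivalence.to (accepts-word⇔ t₂ (d t₁))
             (same-state-same-future M (prefix t₁) (prefix t₂) _ same
               (Equivalence.from (accepts-word⇔ t₁ (d t₁)) (P-∋ _ (2 ^ L) _ refl refl refl)))
    d₂≡d₁ : d t₂ ≡ d t₁
    d₂≡d₁ = m∣n∧n<2*m⇒m≡n (d t₂) (d t₁) (odd∣2^*⇒∣ (D + toℕ t₂) L (d t₁) (P-⊆ _ in-P)) (s≤s z≤n)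
                          (<-≤-trans (d<2^L t₁) (*-monoʳ-≤ 2 (2*D≤d t₂)))

  contradiction : ⊥
  contradiction with pigeonhole (n<1+n M.size) (λ t → M.index (M.run M.start (prefix t)))
  ... | t₁ , t₂ , t₁<t₂ , same-index = prefixes-reach-distinct-states t₁<t₂ (M.index-injective same-index)

between-divisibility⇒¬Automatic :
  ∀ {P : (Fin 3 → ℕ) → Set} →
  (∀ r K v → v X ≡ suc r → v Y ≡ K * suc r → v Z ≡ suc r → P v) → (∀ v → P v → v X ∣ v Y) →
  ¬ Automatic 3 P
between-divisibility⇒¬Automatic P-∋ P-⊆ a = Pumping.contradiction P-∋ P-⊆ a

-- The equation xy = yz with x ∈ a*b and y ∈ ε + (a+b)*b

pattern 𝐚 = zero
pattern 𝐛 = suc zero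

aʳb : ℕ → List (Fin 2)
aʳb r = replicate r 𝐚 ++ [ 𝐛 ]

xy≐yz : WordEquation 2 3
xy≐yz = (inj₂ X ∷ inj₂ Y ∷ []) ≐ (inj₂ Y ∷ inj₂ Z ∷ [])

xy≐yz-regular : Regular xy≐yz
xy≐yz-regular X = s≤s z≤n , z≤n
xy≐yz-regular Y = s≤s z≤n , s≤s z≤n
xy≐yz-regular Z = z≤n     , s≤s z≤n

two-variables-sorted : ∀ {α β : Fin 3} → α <ᶠ β → SortedBy _<ᶠ_ (inj₂ {A = Fin 2} α ∷ inj₂ β ∷ [])
two-variables-sorted α<β []              []          _ _ _ refl = α<β
two-variables-sorted α<β []              (_ ∷ [])    _ _ _ ()
two-variables-sorted α<β []              (_ ∷ _ ∷ _) _ _ _ ()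
two-variables-sorted α<β (_ ∷ [])        []          _ _ _ ()
two-variables-sorted α<β (_ ∷ [])        (_ ∷ _)     _ _ _ ()
two-variables-sorted α<β (_ ∷ _ ∷ [])    _           _ _ _ ()
two-variables-sorted α<β (_ ∷ _ ∷ _ ∷ _) _           _ _ _ ()

xy≐yz-regularOriented : RegularOriented xy≐yz
xy≐yz-regularOriented = xy≐yz-regular ,
  (_<ᶠ_ , <ᶠ-isStrictTotalOrder , two-variables-sorted (s≤s z≤n) , two-variables-sorted (s≤s (s≤s z≤n)))

DFA-run-++ : ∀ {a} (M : DFA a) q u w → Defs.run M q (u ++ w) ≡ Defs.run M (Defs.run M q u) w
DFA-run-++ M q []      w = refl
DFA-run-++ M q (c ∷ u) w = DFA-run-++ M (DFA.δ M q c) u w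

aStarB : DFA 2
aStarB = record { nStates = 3 ; start = 0F ; δ = δ ; final = final }
  where
  δ : Fin 3 → Fin 2 → Fin 3
  δ 0F 𝐚 = 0F
  δ 0F 𝐛 = 1F
  δ _  _ = 2F
  final : Fin 3 → Bool
  final 1F = true
  final _  = false

aStarB-sound : ∀ w → Defs.Accepts aStarB w → ∃ λ r → w ≡ aʳb r
aStarB-sound []          ()
aStarB-sound (𝐚 ∷ w)     acc with aStarB-sound w acc
... | r , w≡aʳb = suc r , cong (𝐚 ∷_) w≡aʳb
aStarB-sound (𝐛 ∷ [])    _   = 0 , refl
aStarB-sound (𝐛 ∷ c ∷ w) acc = case trans (cong (DFA.final aStarB) (sym (dead w))) acc of λ ()
  where
  dead : ∀ w → Defs.run aStarB 2F w ≡ 2F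
  dead []      = refl
  dead (c ∷ w) = dead w

aStarB-complete : ∀ r → Defs.Accepts aStarB (aʳb r)
aStarB-complete zero    = refl
aStarB-complete (suc r) = aStarB-complete r

emptyOrEndsInB : DFA 2
emptyOrEndsInB = record { nStates = 2 ; start = 0F ; δ = λ _ c → δ c ; final = final }
  where
  δ : Fin 2 → Fin 2
  δ 𝐚 = 1F
  δ 𝐛 = 0F
  final : Fin 2 → Bool
  final 0F = true
  final 1F = false

module EndsInB where

  open DFA emptyOrEndsInB using (start)
  private
    run = Defs.run emptyOrEndsInB

  Accepted : List (Fin 2) → Set
  Accepted = Defs.Accepts emptyOrEndsInB

  run-∷ : ∀ q q′ c w → run q (c ∷ w) ≡ run q′ (c ∷ w)
  run-∷ q q′ 𝐚 w = refl
  run-∷ q q′ 𝐛 w = refl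

  suffix : ∀ u w → Accepted (u ++ w) → Accepted w
  suffix u []      _   = refl
  suffix u (c ∷ w) acc = trans (cong (DFA.final emptyOrEndsInB)
                                     (trans (run-∷ start (run start u) c w) (sym (DFA-run-++ emptyOrEndsInB start u (c ∷ w))))) acc

  ++-closed : ∀ u w → Accepted u → Accepted w → Accepted (u ++ w)
  ++-closed u []      acc _   = subst Accepted (sym (++-identityʳ u)) acc
  ++-closed u (c ∷ w) _   acc = trans (cong (DFA.final emptyOrEndsInB)
                                          (trans (DFA-run-++ emptyOrEndsInB start u (c ∷ w)) (run-∷ (run start u) start c w))) acc

  ends-in-b : ∀ w → Accepted (w ++ [ 𝐛 ])
  ends-in-b w = cong (DFA.final emptyOrEndsInB) (DFA-run-++ emptyOrEndsInB start w [ 𝐛 ])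

  rejects-a⁺ : ∀ k → ¬ Accepted (replicate (suc k) 𝐚)
  rejects-a⁺ k acc = case trans (cong (DFA.final emptyOrEndsInB) (sym (ends-in-a k start))) acc of λ ()
    where
    ends-in-a : ∀ k q → run q (replicate (suc k) 𝐚) ≡ 1F
    ends-in-a zero    q = refl
    ends-in-a (suc k) q = ends-in-a k 1F

++-prefix : ∀ {A : Set} (xs ys zs ws : List A) → xs ++ ys ≡ zs ++ ws → length xs ≤ length zs →
            ∃ λ us → zs ≡ xs ++ us
++-prefix []       ys zs       ws _  _         = zs , refl
++-prefix (x ∷ xs) ys (z ∷ zs) ws eq (s≤s |xs|≤|zs|) with ∷-injective eq
... | refl , eq′ with ++-prefix xs ys zs ws eq′ |xs|≤|zs|
... | us , zs≡xs++us = us , cong (x ∷_) zs≡xs++us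

short-prefix-of-aʳb : ∀ y v r → y ++ v ≡ aʳb r → length y ≤ r → y ≡ replicate (length y) 𝐚
short-prefix-of-aʳb []      v r       _  _           = refl
short-prefix-of-aʳb (c ∷ y) v (suc r) eq (s≤s |y|≤r) with ∷-injective eq
... | refl , eq′ = cong (𝐚 ∷_) (short-prefix-of-aʳb y v r eq′ |y|≤r)

length-aʳb : ∀ r → length (aʳb r) ≡ suc r
length-aʳb r = trans (length-++ (replicate r 𝐚)) (trans (cong (_+ 1) (length-replicate r)) (+-comm r 1))

conjugate-length-∣ : ∀ k r y z → length y ≤ k → aʳb r ++ y ≡ y ++ z →
                     EndsInB.Accepted y → suc r ∣ length y
conjugate-length-∣ k       r []      z _ _  _   = suc r ∣0
conjugate-length-∣ zero    r (c ∷ y) z () _ _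
conjugate-length-∣ (suc k) r (c ∷ y) z |y|≤1+k xy≡yz acc with suc r ≤? length (c ∷ y)
... | yes |x|≤|y| =
  subst (suc r ∣_) (sym |y|≡|x|+|u|) (∣m∣n⇒∣m+n ∣-refl (conjugate-length-∣ k r u z |u|≤k xu≡uz u-acc))
  where
  x = aʳb r
  split = ++-prefix x (c ∷ y) (c ∷ y) z xy≡yz (subst (_≤ length (c ∷ y)) (sym (length-aʳb r)) |x|≤|y|)
  u = proj₁ split
  y≡xu = proj₂ split
  |y|≡|x|+|u| : length (c ∷ y) ≡ suc r + length u
  |y|≡|x|+|u| = trans (cong length y≡xu) (trans (length-++ x) (cong (_+ length u) (length-aʳb r)))
  |u|≤k : length u ≤ k
  |u|≤k = ≤-pred (≤-trans (≤-trans (s≤s (m≤n+m (length u) r)) (≤-reflexive (sym |y|≡|x|+|u|))) |y|≤1+k)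
  xu≡uz : x ++ u ≡ u ++ z
  xu≡uz = ++-cancelˡ x (x ++ u) (u ++ z)
            (trans (subst (λ y′ → x ++ y′ ≡ y′ ++ z) y≡xu xy≡yz) (++-assoc x u z))
  u-acc : EndsInB.Accepted u
  u-acc = EndsInB.suffix x u (subst EndsInB.Accepted y≡xu acc)
... | no  |x|≰|y| = ⊥-elim (EndsInB.rejects-a⁺ (length y) (subst EndsInB.Accepted y≡aⁿ acc))
  where
  x = aʳb r
  |y|≤r : length (c ∷ y) ≤ r
  |y|≤r = ≤-pred (≰⇒> |x|≰|y|)
  split = ++-prefix (c ∷ y) z x (c ∷ y) (sym xy≡yz)
                    (≤-trans |y|≤r (≤-trans (n≤1+n r) (≤-reflexive (sym (length-aʳb r)))))
  y≡aⁿ : c ∷ y ≡ replicate (suc (length y)) 𝐚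
  y≡aⁿ = short-prefix-of-aʳb (c ∷ y) (proj₁ split) r (sym (proj₂ split)) |y|≤r

power : List (Fin 2) → ℕ → List (Fin 2)
power x zero    = []
power x (suc K) = x ++ power x K

power-comm : ∀ x K → x ++ power x K ≡ power x K ++ x
power-comm x zero    = ++-identityʳ x
power-comm x (suc K) = trans (cong (x ++_) (power-comm x K)) (sym (++-assoc x (power x K) x))

length-power : ∀ x K → length (power x K) ≡ K * length x
length-power x zero    = refl
length-power x (suc K) = trans (length-++ x) (cong (length x +_) (length-power x K))

power-endsInB : ∀ x K → EndsInB.Accepted x → EndsInB.Accepted (power x K)
power-endsInB x zero    _   = refl
power-endsInB x (suc K) acc = EndsInB.++-closed x (power x K) acc (power-endsInB x K acc)

constraints : List (RegConstraint 2 3)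
constraints = (X , aStarB) ∷ (Y , emptyOrEndsInB) ∷ []

xy≐yz-solution : ∀ σ → IsSolution σ xy≐yz ⇔ (σ X ++ σ Y ≡ σ Y ++ σ Z)
xy≐yz-solution σ = mk⇔
  (λ eq → trans (cong (σ X ++_) (sym (++-identityʳ (σ Y)))) (trans eq (cong (σ Y ++_) (++-identityʳ (σ Z)))))
  (λ eq → trans (cong (σ X ++_) (++-identityʳ (σ Y))) (trans eq (cong (σ Y ++_) (sym (++-identityʳ (σ Z))))))

lengthAbstraction-∋ : ∀ r K v → v X ≡ suc r → v Y ≡ K * suc r → v Z ≡ suc r →
                      LengthAbstraction xy≐yz constraints v
lengthAbstraction-∋ r K v vX vY vZ =
  σ , solution , aStarB-complete r ∷ power-endsInB x K (EndsInB.ends-in-b (replicate r 𝐚)) ∷ [] , lengths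
  where
  x = aʳb r
  σ : Assignment 2 3
  σ X = x
  σ Y = power x K
  σ Z = x
  solution : IsSolution σ xy≐yz
  solution = Equivalence.from (xy≐yz-solution σ) (power-comm x K)
  lengths : ∀ i → length (σ i) ≡ v i
  lengths X = trans (length-aʳb r) (sym vX)
  lengths Y = trans (length-power x K) (trans (cong (K *_) (length-aʳb r)) (sym vY))
  lengths Z = trans (length-aʳb r) (sym vZ)

lengthAbstraction-⊆ : ∀ v → LengthAbstraction xy≐yz constraints v → v X ∣ v Y
lengthAbstraction-⊆ v (σ , solution , σX-acc ∷ σY-acc ∷ [] , lengths) with aStarB-sound (σ X) σX-acc
... | r , σX≡aʳb = subst₂ _∣_ (trans (sym (length-aʳb r)) (trans (cong length (sym σX≡aʳb)) (lengths X))) (lengths Y)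
  (conjugate-length-∣ (length (σ Y)) r (σ Y) (σ Z) ≤-refl
    (subst (λ x → x ++ σ Y ≡ σ Y ++ σ Z) σX≡aʳb (Equivalence.to (xy≐yz-solution σ) solution)) σY-acc)

proposition4 : Σ ℕ λ a → Σ ℕ λ k → Σ (WordEquation a k) λ e →
                 Σ (List (RegConstraint a k)) λ S →
                   RegularOriented e × ¬ PresburgerDefinable (LengthAbstraction e S)
proposition4 = 2 , 3 , xy≐yz , constraints , xy≐yz-regularOriented ,
  λ definable → between-divisibility⇒¬Automatic lengthAbstraction-∋ lengthAbstraction-⊆
                  (PresburgerDefinable⇒Automatic definable)
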